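{- Let $G$ be a finite graph and let $G^-$ be a graph obtained from $G$ by deleting one edge (keeping all vertices). Then $v(G^-)\ge v(G)-1$.
   Context: $v(H)$ is the minimum number of points of a linear hypergraph (finite point set, lines are subsets of size $\ge2$, two distinct points in at most one line) whose intersection graph (vertices = lines, adjacent iff distinct and intersecting) is isomorphic to $H$. -}

module Defs where

open import Data.Nat using (ℕ; _≤_)
open import Data.Bool using (Bool; true; false; _∧_; _∨_; not)
open import Data.Fin using (Fin)
open import Data.Fin.Properties using (_≟_)
open import Data.Fin.Subset using (Subset; _∈_; ∣_∣)
open import Data.Product using (Σ; ∃; _×_)
open import Relation.Binary.PropositionalEquality using (_≡_; _≢_)
open import Relation.Nullary.Decidable using (⌊_⌋)
open import Function.Bundles using (_⇔_)

record Graph : Set where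
  field
    n     : ℕ
    adj   : Fin n → Fin n → Bool
    sym   : ∀ x y → adj x y ≡ adj y x
    irrefl : ∀ x → adj x x ≡ false
open Graph public

sameEdge : ∀ {n} → Fin n → Fin n → Fin n → Fin n → Bool
sameEdge u v x y = (⌊ x ≟ u ⌋ ∧ ⌊ y ≟ v ⌋) ∨ (⌊ x ≟ v ⌋ ∧ ⌊ y ≟ u ⌋)

DeleteEdge : (G H : Graph) → Set
DeleteEdge G H =
  Σ (n H ≡ n G) λ { _≡_.refl →
    Σ (Fin (n G)) λ u → Σ (Fin (n G)) λ v →
      (adj G u v ≡ true) ×
      (∀ x y → adj H x y ≡ (adj G x y ∧ not (sameEdge u v x y))) }

record IsLinear (p m : ℕ) (L : Fin m → Subset p) : Set where
  field
    size2  : ∀ i → 2 ≤ ∣ L i ∣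
    linear : ∀ (x y : Fin p) → x ≢ y → ∀ (i j : Fin m) →
             x ∈ L i → y ∈ L i → x ∈ L j → y ∈ L j → i ≡ j

-- H is (isomorphic to) the intersection graph of a linear hypergraph with p
-- points: lines are indexed by the vertices of H, and two distinct lines meet
-- iff the corresponding vertices are adjacent.
Representable : Graph → ℕ → Set
Representable H p =
  Σ (Fin (n H) → Subset p) λ L →
    IsLinear p (n H) L ×
    (∀ i j → i ≢ j → (adj H i j ≡ true ⇔ ∃ λ x → x ∈ L i × x ∈ L j))

IsV : Graph → ℕ → Set
IsV H k = Representable H k × (∀ p → Representable H p → k ≤ p)

{-# OPTIONS --safe #-}
module Submission where

-- Given a representation of G⁻ on p points, adjoin one new point lying exactly
-- on the two lines of the endpoints u, v of the deleted edge. Since u and v are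
-- non-adjacent in G⁻ these two lines were disjoint, so the new point creates no
-- second common point of two lines and the hypergraph stays linear; and it makes
-- exactly the lines of u and v meet. Hence G is representable on p + 1 points.

open import Defs
open import Data.Nat using (ℕ; _≤_; suc)
open import Data.Nat.Properties using (≤-trans)
open import Data.Bool using (Bool; true; false; _∧_; _∨_; not)
open import Data.Bool.Properties using (∧-zeroʳ; ∧-identityʳ)
open import Data.Fin using (Fin; zero; suc)
open import Data.Fin.Properties using (_≟_)
open import Data.Fin.Subset using (Subset; _∈_)
open import Data.Fin.Subset.Properties using (∣p∣≤∣x∷p∣; drop-there)
open import Data.Vec using (_∷_; here; there)
open import Data.Product using (∃; _×_; _,_)
open import Data.Sum using (_⊎_; inj₁; inj₂)
open import Data.Sum.Function.Propositional using (_⊎-⇔_)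
open import Data.Empty using (⊥-elim)
open import Relation.Binary.PropositionalEquality
  using (_≡_; _≢_; refl; trans; cong; ≢-sym)
import Relation.Binary.PropositionalEquality as ≡
open import Relation.Nullary using (¬_; yes; no; contradiction)
open import Relation.Nullary.Decidable using (⌊_⌋)
open import Function.Bundles using (_⇔_; mk⇔; Equivalence)
open import Function.Construct.Identity using (⇔-id)
open import Function.Construct.Symmetry using (⇔-sym)
open import Function.Related.Propositional using (module EquationalReasoning)

_meets_ : ∀ {p} → Subset p → Subset p → Set
s meets t = ∃ λ x → x ∈ s × x ∈ t

∨≡true⇔ : ∀ {a b} → a ∨ b ≡ true ⇔ (a ≡ true ⊎ b ≡ true)
∨≡true⇔ {true}  = mk⇔ inj₁ (λ _ → refl)
∨≡true⇔ {false} = mk⇔ inj₂ λ { (inj₁ ()) ; (inj₂ b≡true) → b≡true }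

zero∈∷-both⇒∧ : ∀ {p} {s t : Bool} {P Q : Subset p} →
                zero ∈ s ∷ P → zero ∈ t ∷ Q → s ∧ t ≡ true
zero∈∷-both⇒∧ here here = refl

∷-meets : ∀ {p} {s t : Bool} {P Q : Subset p} →
          (s ∷ P) meets (t ∷ Q) ⇔ (s ∧ t ≡ true ⊎ P meets Q)
∷-meets = mk⇔ to from
  where
  to : ∀ {p} {s t : Bool} {P Q : Subset p} → (s ∷ P) meets (t ∷ Q) → s ∧ t ≡ true ⊎ P meets Q
  to (zero  , x∈sP , x∈tQ) = inj₁ (zero∈∷-both⇒∧ x∈sP x∈tQ)
  to (suc x , x∈sP , x∈tQ) = inj₂ (x , drop-there x∈sP , drop-there x∈tQ)
  from : ∀ {p} {s t : Bool} {P Q : Subset p} → s ∧ t ≡ true ⊎ P meets Q → (s ∷ P) meets (t ∷ Q)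
  from {s = true} {true} (inj₁ refl) = zero , here , here
  from (inj₂ (x , x∈P , x∈Q))       = suc x , there x∈P , there x∈Q

module _ {p m : ℕ} (L : Fin m → Subset p) (T : Fin m → Bool) where

  addPoint : Fin m → Subset (suc p)
  addPoint i = T i ∷ L i

  addPoint-isLinear : IsLinear p m L →
                      (∀ i j → i ≢ j → T i ∧ T j ≡ true → ¬ L i meets L j) →
                      IsLinear (suc p) m addPoint
  addPoint-isLinear L-linear marked-disjoint = record
    { size2  = λ i → ≤-trans (IsLinear.size2 L-linear i) (∣p∣≤∣x∷p∣ (T i) (L i))
    ; linear = linear
    }
    where
    linear : ∀ (x y : Fin (suc p)) → x ≢ y → ∀ (i j : Fin m) →
             x ∈ addPoint i → y ∈ addPoint i → x ∈ addPoint j → y ∈ addPoint j → i ≡ j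
    linear zero    zero    x≢y _ _ _ _ _ _ = ⊥-elim (x≢y refl)
    linear (suc x) (suc y) x≢y i j x∈i y∈i x∈j y∈j =
      IsLinear.linear L-linear x y (λ x≡y → x≢y (cong suc x≡y)) i j
        (drop-there x∈i) (drop-there y∈i) (drop-there x∈j) (drop-there y∈j)
    linear zero    (suc y) _   i j x∈i y∈i x∈j y∈j with i ≟ j
    ... | yes i≡j = i≡j
    ... | no  i≢j = ⊥-elim (marked-disjoint i j i≢j (zero∈∷-both⇒∧ x∈i x∈j)
                              (y , drop-there y∈i , drop-there y∈j))
    linear (suc x) zero    x≢y i j x∈i y∈i x∈j y∈j =
      linear zero (suc x) (≢-sym x≢y) i j y∈i x∈i y∈j x∈j

module _ {N : ℕ} (u v : Fin N) where

  isEndpoint : Fin N → Bool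
  isEndpoint i = ⌊ i ≟ u ⌋ ∨ ⌊ i ≟ v ⌋

  isEndpoint-∧ : ∀ {i j} → i ≢ j → isEndpoint i ∧ isEndpoint j ≡ sameEdge u v i j
  isEndpoint-∧ {i} {j} i≢j with i ≟ u | i ≟ v | j ≟ u | j ≟ v
  ... | yes refl | _      | yes refl | _        = ⊥-elim (i≢j refl)
  ... | _        | yes refl | _      | yes refl = ⊥-elim (i≢j refl)
  ... | yes _ | yes _ | no _  | no _  = refl
  ... | yes _ | no _  | no _  | yes _ = refl
  ... | yes _ | no _  | no _  | no _  = refl
  ... | no _  | yes _ | yes _ | no _  = refl
  ... | no _  | yes _ | no _  | no _  = refl
  ... | no _  | no _  | yes _ | yes _ = refl
  ... | no _  | no _  | yes _ | no _  = refl
  ... | no _  | no _  | no _  | yes _ = refl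
  ... | no _  | no _  | no _  | no _  = refl

sameEdge⇒adj : (G : Graph) {u v : Fin (n G)} → adj G u v ≡ true →
               ∀ i j → sameEdge u v i j ≡ true → adj G i j ≡ true
sameEdge⇒adj G {u} {v} uv∈G i j same with i ≟ u | j ≟ v | i ≟ v | j ≟ u
... | yes refl | yes refl | _        | _        = uv∈G
... | _        | _        | yes refl | yes refl = trans (Graph.sym G v u) uv∈G
... | no _  | _     | no _  | _     = contradiction same λ ()
... | no _  | _     | yes _ | no _  = contradiction same λ ()
... | yes _ | no _  | no _  | _     = contradiction same λ ()
... | yes _ | no _  | yes _ | no _  = contradiction same λ ()

representable-reinsertEdge : ∀ {G G⁻ p} → DeleteEdge G G⁻ →
                             Representable G⁻ p → Representable G (suc p)
representable-reinsertEdge {G} {G⁻} (refl , u , v , uv∈G , adj⁻) (L , L-linear , L-meets) =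
  addPoint L T , addPoint-isLinear L T L-linear endpoints-disjoint , adj⇔meets
  where
  T : Fin (n G) → Bool
  T = isEndpoint u v

  adj-restore : ∀ i j → adj G i j ≡ sameEdge u v i j ∨ adj G⁻ i j
  adj-restore i j rewrite adj⁻ i j with sameEdge u v i j in same
  ... | true  = sameEdge⇒adj G uv∈G i j same
  ... | false = ≡.sym (∧-identityʳ (adj G i j))

  adj-via-endpoints : ∀ {i j} → i ≢ j → adj G i j ≡ (T i ∧ T j) ∨ adj G⁻ i j
  adj-via-endpoints {i} {j} i≢j =
    trans (adj-restore i j) (cong (_∨ adj G⁻ i j) (≡.sym (isEndpoint-∧ u v i≢j)))

  endpoints-disjoint : ∀ i j → i ≢ j → T i ∧ T j ≡ true → ¬ L i meets L j
  endpoints-disjoint i j i≢j Tij L-meet =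
    contradiction (trans (≡.sym adj⁻≡false) (Equivalence.from (L-meets i j i≢j) L-meet)) λ ()
    where
    same : sameEdge u v i j ≡ true
    same = trans (≡.sym (isEndpoint-∧ u v i≢j)) Tij

    adj⁻≡false : adj G⁻ i j ≡ false
    adj⁻≡false = begin
      adj G⁻ i j                          ≡⟨ adj⁻ i j ⟩
      adj G i j ∧ not (sameEdge u v i j)  ≡⟨ cong (λ s → adj G i j ∧ not s) same ⟩
      adj G i j ∧ false                   ≡⟨ ∧-zeroʳ (adj G i j) ⟩
      false                               ∎
      where open ≡.≡-Reasoning

  adj⇔meets : ∀ i j → i ≢ j → adj G i j ≡ true ⇔ addPoint L T i meets addPoint L T j
  adj⇔meets i j i≢j = begin
    adj G i j ≡ true                        ≡⟨ cong (_≡ true) (adj-via-endpoints i≢j) ⟩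
    (T i ∧ T j) ∨ adj G⁻ i j ≡ true         ∼⟨ ∨≡true⇔ ⟩
    (T i ∧ T j ≡ true ⊎ adj G⁻ i j ≡ true)  ∼⟨ ⇔-id _ ⊎-⇔ L-meets i j i≢j ⟩
    (T i ∧ T j ≡ true ⊎ L i meets L j)      ∼⟨ ⇔-sym ∷-meets ⟩
    addPoint L T i meets addPoint L T j     ∎
    where open EquationalReasoning

mainTheorem20 : (G G⁻ : Graph) → DeleteEdge G G⁻ →
                (a b : ℕ) → IsV G a → IsV G⁻ b → a ≤ suc b
mainTheorem20 G G⁻ G⁻-deletes-edge a b (_ , a-minimal) (G⁻-on-b-points , _) =
  a-minimal (suc b) (representable-reinsertEdge G⁻-deletes-edge G⁻-on-b-points)
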